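{- Let $t$ be a meaningless term and $F$ a full context. If there is a derivation in system $\mathcal B$ of $\Gamma\vdash F\langle t\rangle:\sigma$ all of whose judgments have testable typings, then for every term $u$ there is a derivation in $\mathcal B$ of $\Gamma\vdash F\langle u\rangle:\sigma$ all of whose judgments have testable typings.
   Context: Terms: $t ::= x \mid t\,u \mid \lambda x.t \mid\ !t \mid \mathrm{der}(t) \mid t[x\backslash u]$ (usual binders, $\alpha$-equivalence, capture-avoiding substitution $t\{x:=u\}$). List contexts $L ::= \langle\cdot\rangle \mid L[x\backslash t]$; surface contexts $S ::= \langle\cdot\rangle \mid S t \mid t S \mid \lambda x.S \mid \mathrm{der}(S) \mid S[x\backslash t] \mid t[x\backslash S]$; full contexts $F ::= \langle\cdot\rangle \mid F t \mid t F \mid \lambda x.F \mid \mathrm{der}(F) \mid F[x\backslash t] \mid t[x\backslash F] \mid\ !F$. Rules (capture-free): $L\langle\lambda x.t\rangle u\mapsto L\langle t[x\backslash u]\rangle$; $t[x\backslash L\langle !u\rangle]\mapsto L\langle t\{x:=u\}\rangle$; $\mathrm{der}(L\langle !t\rangle)\mapsto L\langle t\rangle$; $\to_S$ is their closure under surface contexts. Testing contexts $T ::= \langle\cdot\rangle \mid T s \mid (\lambda x.T) s$. $t$ is meaningful if $T\langle t\rangle\to_S^*\ !u$ for some testing context $T$ and term $u$; meaningless otherwise. Types $\sigma ::= \alpha \mid \mathcal M \mid \mathcal M\to\sigma$, multitypes finite multisets of types; environments map variables to multitypes (finitely many non-empty), $+$ pointwise union, image = non-empty values. System $\mathcal B$: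 (var) $x:[\sigma]\vdash x:\sigma$; (abs) $\Gamma,x:\mathcal M\vdash t:\sigma\Rightarrow\Gamma\vdash\lambda x.t:\mathcal M\to\sigma$; (app) $\Gamma\vdash t:\mathcal M\to\sigma$, $\Delta\vdash u:\mathcal M\Rightarrow\Gamma+\Delta\vdash tu:\sigma$; (es) $\Gamma,x:\mathcal M\vdash t:\sigma$, $\Delta\vdash u:\mathcal M\Rightarrow\Gamma+\Delta\vdash t[x\backslash u]:\sigma$; (bg) $(\Gamma_i\vdash t:\sigma_i)_{i\in I}$ ($I$ finite, possibly empty) $\Rightarrow+_i\Gamma_i\vdash !t:[\sigma_i]_{i\in I}$; (dr) $\Gamma\vdash t:[\sigma]\Rightarrow\Gamma\vdash\mathrm{der}(t):\sigma$. A type is inhabited if $\emptyset\vdash u:\sigma$ is derivable for some $u$; $\mathrm{args}(\mathcal M)=\mathrm{args}(\alpha)=\emptyset$, $\mathrm{args}(\mathcal M\to\sigma)=\{\mathcal M\}\cup\mathrm{args}(\sigma)$; a typing $(\Gamma;\sigma)$ is testable if all multitypes in the image of $\Gamma$ and all elements of $\mathrm{args}(\sigma)$ are inhabited. -}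

module Defs where

open import Data.Nat using (ℕ; zero; suc; _+_; _≡ᵇ_)
open import Data.Bool using (if_then_else_)
open import Data.List using (List; []; _∷_; [_]; _++_)
open import Data.List.Relation.Unary.All using (All)
open import Data.Product using (Σ; _×_; _,_)
open import Data.Unit using (⊤)
open import Relation.Nullary using (¬_)
open import Relation.Binary.PropositionalEquality using (_≡_)
open import Relation.Binary.Construct.Closure.ReflexiveTransitive using (Star)

-- Terms (de Bruijn indices; α-equivalence is syntactic identity)
--   lam t      = λx.t        (binds index 0 in t)
--   es t u     = t[x\u]      (binds index 0 in t, not in u)

data Term : Set where
  var  : ℕ → Term
  app  : Term → Term → Term
  lam  : Term → Term
  bang : Term → Term
  der  : Term → Term
  es   : Term → Term → Term

ext : (ℕ → ℕ) → ℕ → ℕ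
ext ρ zero    = zero
ext ρ (suc n) = suc (ρ n)

rename : (ℕ → ℕ) → Term → Term
rename ρ (var n)  = var (ρ n)
rename ρ (app t u) = app (rename ρ t) (rename ρ u)
rename ρ (lam t)  = lam (rename (ext ρ) t)
rename ρ (bang t) = bang (rename ρ t)
rename ρ (der t)  = der (rename ρ t)
rename ρ (es t u) = es (rename (ext ρ) t) (rename ρ u)

exts : (ℕ → Term) → ℕ → Term
exts s zero    = var zero
exts s (suc n) = rename suc (s n)

subst : (ℕ → Term) → Term → Term
subst s (var n)  = s n
subst s (app t u) = app (subst s t) (subst s u)
subst s (lam t)  = lam (subst (exts s) t)
subst s (bang t) = bang (subst s t)
subst s (der t)  = der (subst s t)
subst s (es t u) = es (subst (exts s) t) (subst s u)

shift : ℕ → Term → Term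
shift k = rename (k +_)

data LCtx : Set where
  hole : LCtx
  esL  : LCtx → Term → LCtx

plugL : LCtx → Term → Term
plugL hole       t = t
plugL (esL L s)  t = es (plugL L t) s

lenL : LCtx → ℕ
lenL hole      = zero
lenL (esL L _) = suc (lenL L)

data SCtx : Set where
  hole  : SCtx
  appL  : SCtx → Term → SCtx
  appR  : Term → SCtx → SCtx
  lamS  : SCtx → SCtx
  derS  : SCtx → SCtx
  esL   : SCtx → Term → SCtx
  esR   : Term → SCtx → SCtx

plugS : SCtx → Term → Term
plugS hole       t = t
plugS (appL S s) t = app (plugS S t) s
plugS (appR s S) t = app s (plugS S t)
plugS (lamS S)   t = lam (plugS S t)
plugS (derS S)   t = der (plugS S t)
plugS (esL S s)  t = es (plugS S t) s
plugS (esR s S)  t = es s (plugS S t)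

-- full contexts (plugging may capture variables)
data FCtx : Set where
  hole  : FCtx
  appL  : FCtx → Term → FCtx
  appR  : Term → FCtx → FCtx
  lamF  : FCtx → FCtx
  derF  : FCtx → FCtx
  esL   : FCtx → Term → FCtx
  esR   : Term → FCtx → FCtx
  bangF : FCtx → FCtx

plugF : FCtx → Term → Term
plugF hole       t = t
plugF (appL F s) t = app (plugF F t) s
plugF (appR s F) t = app s (plugF F t)
plugF (lamF F)   t = lam (plugF F t)
plugF (derF F)   t = der (plugF F t)
plugF (esL F s)  t = es (plugF F t) s
plugF (esR s F)  t = es s (plugF F t)
plugF (bangF F)  t = bang (plugF F t)

data TCtx : Set where
  hole   : TCtx
  appT   : TCtx → Term → TCtx
  lamApp : TCtx → Term → TCtx

plugT : TCtx → Term → Term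
plugT hole         t = t
plugT (appT T s)   t = app (plugT T t) s
plugT (lamApp T s) t = app (lam (plugT T t)) s

-- substitution used by the ms rule: index 0 ↦ u, index (suc n) ↦ n
-- weakened past the k binders of L
msSub : ℕ → Term → ℕ → Term
msSub k u zero    = u
msSub k u (suc n) = var (k + n)

data _↦_ : Term → Term → Set where
  dB : (L : LCtx) (t u : Term) →
       app (plugL L (lam t)) u ↦ plugL L (es t (shift (lenL L) u))
  ms : (L : LCtx) (t u : Term) →
       es t (plugL L (bang u)) ↦ plugL L (subst (msSub (lenL L) u) t)
  dr : (L : LCtx) (t : Term) →
       der (plugL L (bang t)) ↦ plugL L t

data _→S_ : Term → Term → Set where
  ctx : (S : SCtx) {t u : Term} → t ↦ u → plugS S t →S plugS S u

_→S*_ : Term → Term → Set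
_→S*_ = Star _→S_

Meaningful : Term → Set
Meaningful t = Σ TCtx λ T → Σ Term λ u → plugT T t →S* bang u

Meaningless : Term → Set
Meaningless t = ¬ Meaningful t

-- Types: σ ::= α | M | M → σ ; multitypes represented as lists,
-- considered up to the equivalence ≈ (permutation, recursively)

data Ty : Set where
  atom : ℕ → Ty
  mt   : List Ty → Ty
  arr  : List Ty → Ty → Ty

MType : Set
MType = List Ty

mutual
  data _≈_ : Ty → Ty → Set where
    atom : (n : ℕ) → atom n ≈ atom n
    mt   : {M N : MType} → M ≈ₘ N → mt M ≈ mt N
    arr  : {M N : MType} {σ τ : Ty} → M ≈ₘ N → σ ≈ τ → arr M σ ≈ arr N τ

  data _≈ₘ_ : MType → MType → Set where
    []    : [] ≈ₘ []
    _∷_   : {σ τ : Ty} {M N : MType} → σ ≈ τ → M ≈ₘ N → (σ ∷ M) ≈ₘ (τ ∷ N)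
    swap  : {σ σ' τ τ' : Ty} {M N : MType} → σ ≈ σ' → τ ≈ τ' → M ≈ₘ N →
            (σ ∷ τ ∷ M) ≈ₘ (τ' ∷ σ' ∷ N)
    trans : {M N K : MType} → M ≈ₘ N → N ≈ₘ K → M ≈ₘ K

args : Ty → List MType
args (atom _)  = []
args (mt _)    = []
args (arr M σ) = M ∷ args σ

Env : Set
Env = ℕ → MType

∅ : Env
∅ _ = []

_+ₑ_ : Env → Env → Env
(Γ +ₑ Δ) n = Γ n ++ Δ n

tail : Env → Env
tail Γ n = Γ (suc n)

single : ℕ → Ty → Env
single x σ n = if n ≡ᵇ x then [ σ ] else []

_≈ₑ_ : Env → Env → Set
Γ ≈ₑ Δ = (n : ℕ) → Γ n ≈ₘ Δ n

-- System B
-- abs : from Γ,x:M ⊢ t:σ (Γ extended at index 0) derive Γ ⊢ λx.t : M → σ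
-- es  : likewise for t[x\u]

mutual
  data _⊢_∶_ : Env → Term → Ty → Set where
    var : (x : ℕ) (σ : Ty) → single x σ ⊢ var x ∶ σ
    abs : {Γ : Env} {t : Term} {σ : Ty} →
          Γ ⊢ t ∶ σ → tail Γ ⊢ lam t ∶ arr (Γ zero) σ
    app : {Γ Δ : Env} {t u : Term} {M : MType} {σ : Ty} →
          Γ ⊢ t ∶ arr M σ → Δ ⊢ u ∶ mt M → (Γ +ₑ Δ) ⊢ app t u ∶ σ
    es  : {Γ Δ : Env} {t u : Term} {σ : Ty} →
          Γ ⊢ t ∶ σ → Δ ⊢ u ∶ mt (Γ zero) → (tail Γ +ₑ Δ) ⊢ es t u ∶ σ
    bg  : {Γ : Env} {t : Term} {M : MType} →
          BgPrem Γ t M → Γ ⊢ bang t ∶ mt M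
    dr  : {Γ : Env} {t : Term} {σ : Ty} →
          Γ ⊢ t ∶ mt [ σ ] → Γ ⊢ der t ∶ σ

  -- the finite family of premises (Γᵢ ⊢ t : σᵢ)ᵢ of the bg rule,
  -- with Γ = +ᵢ Γᵢ and M = [σᵢ]ᵢ
  data BgPrem : Env → Term → MType → Set where
    []  : {t : Term} → BgPrem ∅ t []
    _∷_ : {Γ Δ : Env} {t : Term} {σ : Ty} {M : MType} →
          Γ ⊢ t ∶ σ → BgPrem Δ t M → BgPrem (Γ +ₑ Δ) t (σ ∷ M)

mutual
  AllJ : (P : Env → Ty → Set) {Γ : Env} {t : Term} {σ : Ty} → Γ ⊢ t ∶ σ → Set
  AllJ P {Γ} {_} {σ} D = P Γ σ × AllSub P D

  AllSub : (P : Env → Ty → Set) {Γ : Env} {t : Term} {σ : Ty} → Γ ⊢ t ∶ σ → Set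
  AllSub P (var x σ) = ⊤
  AllSub P (abs D)   = AllJ P D
  AllSub P (app D E) = AllJ P D × AllJ P E
  AllSub P (es D E)  = AllJ P D × AllJ P E
  AllSub P (bg B)    = AllBg P B
  AllSub P (dr D)    = AllJ P D

  AllBg : (P : Env → Ty → Set) {Γ : Env} {t : Term} {M : MType} → BgPrem Γ t M → Set
  AllBg P []      = ⊤
  AllBg P (D ∷ B) = AllJ P D × AllBg P B

Inhabited : Ty → Set
Inhabited σ = Σ Term λ u → Σ Env λ Γ → Σ Ty λ σ' →
              Γ ≈ₑ ∅ × σ' ≈ σ × (Γ ⊢ u ∶ σ')

Testable : Env → Ty → Set
Testable Γ σ = ((x : ℕ) → ¬ (Γ x ≡ []) → Inhabited (mt (Γ x)))
             × All (λ M → Inhabited (mt M)) (args σ)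

-- Types are read as sets of terms closed under surface anti-reduction: a
-- multitype M holds the terms reducing to some !v with v in every element of M,
-- and M → σ the terms mapping realisers of M to realisers of σ (atoms are empty).
-- Every derivation is adequate for this reading.  If Γ ⊢ t : σ is testable, the
-- multitypes of Γ are inhabited, so a testing context (λx.⟨⟩)w can bind each free
-- variable of t to a realiser, and applying the result to realisers of the
-- arguments of σ ends in a multitype, i.e. in a surface reduction to a !-term:
-- t is meaningful.  So a meaningless t types no judgment of a testable
-- derivation, and induction on F replaces it by any u, the hole case being void.
module Submission where

open import Defs
open import Data.Bool using (true; false)
open import Data.Empty using (⊥; ⊥-elim)
open import Data.List using ([]; _∷_; [_]; _++_)
open import Data.List.Relation.Unary.All using (All; []; _∷_)
open import Data.Nat using (ℕ; zero; suc; _+_; _≡ᵇ_; _≤_; _<_; _⊔_; pred; z≤n; s≤s)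
open import Data.Nat.Properties using (m⊔n≤o⇒m≤o; m⊔n≤o⇒n≤o; +-suc; +-identityʳ; m≤m+n)
open import Data.Product using (Σ; _×_; _,_; proj₁; proj₂)
open import Data.Unit using (⊤; tt)
open import Function using (_∘_; _⇔_; mk⇔; Equivalence)
open import Function.Properties.Equivalence using () renaming (trans to ⇔-trans)
open import Relation.Nullary using (¬_)
open import Relation.Binary.PropositionalEquality
  using (_≡_; refl; sym; cong; cong₂) renaming (trans to ≡-trans; subst to transport)
open import Relation.Binary.Construct.Closure.ReflexiveTransitive using (ε; _◅_; _◅◅_; gmap)

open Equivalence using (to; from)

ext-cong : ∀ {ρ ρ'} → (∀ n → ρ n ≡ ρ' n) → ∀ n → ext ρ n ≡ ext ρ' n
ext-cong h zero    = refl
ext-cong h (suc n) = cong suc (h n)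

exts-cong : ∀ {s s'} → (∀ n → s n ≡ s' n) → ∀ n → exts s n ≡ exts s' n
exts-cong h zero    = refl
exts-cong h (suc n) = cong (rename suc) (h n)

rename-cong : ∀ {ρ ρ'} → (∀ n → ρ n ≡ ρ' n) → ∀ t → rename ρ t ≡ rename ρ' t
rename-cong h (var n)   = cong var (h n)
rename-cong h (app t u) = cong₂ app (rename-cong h t) (rename-cong h u)
rename-cong h (lam t)   = cong lam (rename-cong (ext-cong h) t)
rename-cong h (bang t)  = cong bang (rename-cong h t)
rename-cong h (der t)   = cong der (rename-cong h t)
rename-cong h (es t u)  = cong₂ es (rename-cong (ext-cong h) t) (rename-cong h u)

subst-cong : ∀ {s s'} → (∀ n → s n ≡ s' n) → ∀ t → subst s t ≡ subst s' t
subst-cong h (var n)   = h n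
subst-cong h (app t u) = cong₂ app (subst-cong h t) (subst-cong h u)
subst-cong h (lam t)   = cong lam (subst-cong (exts-cong h) t)
subst-cong h (bang t)  = cong bang (subst-cong h t)
subst-cong h (der t)   = cong der (subst-cong h t)
subst-cong h (es t u)  = cong₂ es (subst-cong (exts-cong h) t) (subst-cong h u)

ext-id : ∀ {ρ} → (∀ n → ρ n ≡ n) → ∀ n → ext ρ n ≡ n
ext-id h zero    = refl
ext-id h (suc n) = cong suc (h n)

exts-id : ∀ {s} → (∀ n → s n ≡ var n) → ∀ n → exts s n ≡ var n
exts-id h zero    = refl
exts-id h (suc n) = cong (rename suc) (h n)

rename-id : ∀ {ρ} → (∀ n → ρ n ≡ n) → ∀ t → rename ρ t ≡ t
rename-id h (var n)   = cong var (h n)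
rename-id h (app t u) = cong₂ app (rename-id h t) (rename-id h u)
rename-id h (lam t)   = cong lam (rename-id (ext-id h) t)
rename-id h (bang t)  = cong bang (rename-id h t)
rename-id h (der t)   = cong der (rename-id h t)
rename-id h (es t u)  = cong₂ es (rename-id (ext-id h) t) (rename-id h u)

subst-id : ∀ {s} → (∀ n → s n ≡ var n) → ∀ t → subst s t ≡ t
subst-id h (var n)   = h n
subst-id h (app t u) = cong₂ app (subst-id h t) (subst-id h u)
subst-id h (lam t)   = cong lam (subst-id (exts-id h) t)
subst-id h (bang t)  = cong bang (subst-id h t)
subst-id h (der t)   = cong der (subst-id h t)
subst-id h (es t u)  = cong₂ es (subst-id (exts-id h) t) (subst-id h u)

ext-∘ : ∀ ρ ρ' n → ext ρ (ext ρ' n) ≡ ext (ρ ∘ ρ') n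
ext-∘ ρ ρ' zero    = refl
ext-∘ ρ ρ' (suc n) = refl

rename-rename : ∀ ρ ρ' t → rename ρ (rename ρ' t) ≡ rename (ρ ∘ ρ') t
rename-rename ρ ρ' (var n)   = refl
rename-rename ρ ρ' (app t u) = cong₂ app (rename-rename ρ ρ' t) (rename-rename ρ ρ' u)
rename-rename ρ ρ' (lam t)   =
  cong lam (≡-trans (rename-rename (ext ρ) (ext ρ') t) (rename-cong (ext-∘ ρ ρ') t))
rename-rename ρ ρ' (bang t)  = cong bang (rename-rename ρ ρ' t)
rename-rename ρ ρ' (der t)   = cong der (rename-rename ρ ρ' t)
rename-rename ρ ρ' (es t u)  =
  cong₂ es (≡-trans (rename-rename (ext ρ) (ext ρ') t) (rename-cong (ext-∘ ρ ρ') t))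
           (rename-rename ρ ρ' u)

exts-ext : ∀ s ρ n → exts s (ext ρ n) ≡ exts (s ∘ ρ) n
exts-ext s ρ zero    = refl
exts-ext s ρ (suc n) = refl

subst-rename : ∀ s ρ t → subst s (rename ρ t) ≡ subst (s ∘ ρ) t
subst-rename s ρ (var n)   = refl
subst-rename s ρ (app t u) = cong₂ app (subst-rename s ρ t) (subst-rename s ρ u)
subst-rename s ρ (lam t)   =
  cong lam (≡-trans (subst-rename (exts s) (ext ρ) t) (subst-cong (exts-ext s ρ) t))
subst-rename s ρ (bang t)  = cong bang (subst-rename s ρ t)
subst-rename s ρ (der t)   = cong der (subst-rename s ρ t)
subst-rename s ρ (es t u)  =
  cong₂ es (≡-trans (subst-rename (exts s) (ext ρ) t) (subst-cong (exts-ext s ρ) t))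
           (subst-rename s ρ u)

ext-exts : ∀ ρ s n → rename (ext ρ) (exts s n) ≡ exts (rename ρ ∘ s) n
ext-exts ρ s zero    = refl
ext-exts ρ s (suc n) = ≡-trans (rename-rename (ext ρ) suc (s n)) (sym (rename-rename suc ρ (s n)))

rename-subst : ∀ ρ s t → rename ρ (subst s t) ≡ subst (rename ρ ∘ s) t
rename-subst ρ s (var n)   = refl
rename-subst ρ s (app t u) = cong₂ app (rename-subst ρ s t) (rename-subst ρ s u)
rename-subst ρ s (lam t)   =
  cong lam (≡-trans (rename-subst (ext ρ) (exts s) t) (subst-cong (ext-exts ρ s) t))
rename-subst ρ s (bang t)  = cong bang (rename-subst ρ s t)
rename-subst ρ s (der t)   = cong der (rename-subst ρ s t)
rename-subst ρ s (es t u)  =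
  cong₂ es (≡-trans (rename-subst (ext ρ) (exts s) t) (subst-cong (ext-exts ρ s) t))
           (rename-subst ρ s u)

exts-exts : ∀ s s' n → subst (exts s) (exts s' n) ≡ exts (subst s ∘ s') n
exts-exts s s' zero    = refl
exts-exts s s' (suc n) =
  ≡-trans (subst-rename (exts s) suc (s' n)) (sym (rename-subst suc s (s' n)))

subst-subst : ∀ s s' t → subst s (subst s' t) ≡ subst (subst s ∘ s') t
subst-subst s s' (var n)   = refl
subst-subst s s' (app t u) = cong₂ app (subst-subst s s' t) (subst-subst s s' u)
subst-subst s s' (lam t)   =
  cong lam (≡-trans (subst-subst (exts s) (exts s') t) (subst-cong (exts-exts s s') t))
subst-subst s s' (bang t)  = cong bang (subst-subst s s' t)
subst-subst s s' (der t)   = cong der (subst-subst s s' t)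
subst-subst s s' (es t u)  =
  cong₂ es (≡-trans (subst-subst (exts s) (exts s') t) (subst-cong (exts-exts s s') t))
           (subst-subst s s' u)

_∷ₛ_ : Term → (ℕ → Term) → ℕ → Term
(v ∷ₛ s) zero    = v
(v ∷ₛ s) (suc n) = s n

msSub-exts : ∀ s v t → subst (msSub 0 v) (subst (exts s) t) ≡ subst (v ∷ₛ s) t
msSub-exts s v t = ≡-trans (subst-subst (msSub 0 v) (exts s) t) (subst-cong pointwise t)
  where
  pointwise : ∀ n → subst (msSub 0 v) (exts s n) ≡ (v ∷ₛ s) n
  pointwise zero    = refl
  pointwise (suc n) = ≡-trans (subst-rename (msSub 0 v) suc (s n)) (subst-id (λ _ → refl) (s n))

↦⇒→S* : ∀ {a b} → a ↦ b → a →S* b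
↦⇒→S* r = ctx hole r ◅ ε

→S*-appL : ∀ {a b} s → a →S* b → app a s →S* app b s
→S*-appL s = gmap (λ a → app a s) λ { (ctx S r) → ctx (appL S s) r }

→S*-esR : ∀ {a b} t → a →S* b → es t a →S* es t b
→S*-esR t = gmap (es t) λ { (ctx S r) → ctx (esR t S) r }

→S*-der : ∀ {a b} → a →S* b → der a →S* der b
→S*-der = gmap der λ { (ctx S r) → ctx (derS S) r }

mutual
  ⟦_⟧ : Ty → Term → Set
  ⟦ atom _ ⟧  t = ⊥
  ⟦ mt M ⟧    t = ⟦ M ⟧ₘ t
  ⟦ arr M σ ⟧ t = ∀ s → ⟦ M ⟧ₘ s → ⟦ σ ⟧ (app t s)

  ⟦_⟧ₘ : MType → Term → Set
  ⟦ M ⟧ₘ t = Σ Term λ v → t →S* bang v × ⟦ M ⟧* v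

  -- Not All (λ σ → ⟦ σ ⟧ v) M, which would hide the structural recursion on M.
  ⟦_⟧* : MType → Term → Set
  ⟦ [] ⟧*    v = ⊤
  ⟦ σ ∷ M ⟧* v = ⟦ σ ⟧ v × ⟦ M ⟧* v

⟦⟧-backward : ∀ σ {a b} → a →S* b → ⟦ σ ⟧ b → ⟦ σ ⟧ a
⟦⟧-backward (atom _)  r ()
⟦⟧-backward (mt M)    r (v , r' , ⊩v) = v , r ◅◅ r' , ⊩v
⟦⟧-backward (arr M σ) r f s ⊩s = ⟦⟧-backward σ (→S*-appL s r) (f s ⊩s)

mutual
  ⟦⟧-≈ : ∀ {σ τ} → σ ≈ τ → ∀ t → ⟦ σ ⟧ t ⇔ ⟦ τ ⟧ t
  ⟦⟧-≈ (atom n)  t = mk⇔ (λ x → x) (λ x → x)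
  ⟦⟧-≈ (mt e)    t = ⟦⟧ₘ-≈ₘ e t
  ⟦⟧-≈ (arr e q) t = mk⇔
    (λ f s ⊩s → to (⟦⟧-≈ q (app t s)) (f s (from (⟦⟧ₘ-≈ₘ e s) ⊩s)))
    (λ f s ⊩s → from (⟦⟧-≈ q (app t s)) (f s (to (⟦⟧ₘ-≈ₘ e s) ⊩s)))

  ⟦⟧ₘ-≈ₘ : ∀ {M N} → M ≈ₘ N → ∀ t → ⟦ M ⟧ₘ t ⇔ ⟦ N ⟧ₘ t
  ⟦⟧ₘ-≈ₘ e t = mk⇔
    (λ (v , r , ⊩v) → v , r , to (⟦⟧*-≈ₘ e v) ⊩v)
    (λ (v , r , ⊩v) → v , r , from (⟦⟧*-≈ₘ e v) ⊩v)

  ⟦⟧*-≈ₘ : ∀ {M N} → M ≈ₘ N → ∀ v → ⟦ M ⟧* v ⇔ ⟦ N ⟧* v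
  ⟦⟧*-≈ₘ []             v = mk⇔ (λ x → x) (λ x → x)
  ⟦⟧*-≈ₘ (q ∷ e)        v = mk⇔
    (λ (a , b) → to (⟦⟧-≈ q v) a , to (⟦⟧*-≈ₘ e v) b)
    (λ (a , b) → from (⟦⟧-≈ q v) a , from (⟦⟧*-≈ₘ e v) b)
  ⟦⟧*-≈ₘ (swap q q' e)  v = mk⇔
    (λ (a , b , c) → to (⟦⟧-≈ q' v) b , to (⟦⟧-≈ q v) a , to (⟦⟧*-≈ₘ e v) c)
    (λ (b , a , c) → from (⟦⟧-≈ q v) a , from (⟦⟧-≈ q' v) b , from (⟦⟧*-≈ₘ e v) c)
  ⟦⟧*-≈ₘ (trans e e')   v = ⇔-trans (⟦⟧*-≈ₘ e v) (⟦⟧*-≈ₘ e' v)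

⟦⟧*-++ : ∀ M N v → ⟦ M ++ N ⟧* v → ⟦ M ⟧* v × ⟦ N ⟧* v
⟦⟧*-++ []      N v ⊩v       = tt , ⊩v
⟦⟧*-++ (σ ∷ M) N v (a , ⊩v) =
  let (⊩M , ⊩N) = ⟦⟧*-++ M N v ⊩v in (a , ⊩M) , ⊩N

_⊩_ : (ℕ → Term) → Env → Set
ρ ⊩ Γ = ∀ x → ⟦ Γ x ⟧* (ρ x)

_⊨_∶_ : Env → Term → Ty → Set
Γ ⊨ t ∶ σ = ∀ ρ → ρ ⊩ Γ → ⟦ σ ⟧ (subst ρ t)

⊩-+ₑ : ∀ {Γ Δ ρ} → ρ ⊩ (Γ +ₑ Δ) → ρ ⊩ Γ × ρ ⊩ Δ
⊩-+ₑ {Γ} {Δ} {ρ} ⊩ρ =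
  (λ x → proj₁ (⟦⟧*-++ (Γ x) (Δ x) (ρ x) (⊩ρ x))) ,
  (λ x → proj₂ (⟦⟧*-++ (Γ x) (Δ x) (ρ x) (⊩ρ x)))

⊩-∷ₛ : ∀ {Γ ρ v} → ⟦ Γ zero ⟧* v → ρ ⊩ tail Γ → (v ∷ₛ ρ) ⊩ Γ
⊩-∷ₛ ⊩v ⊩ρ zero    = ⊩v
⊩-∷ₛ ⊩v ⊩ρ (suc x) = ⊩ρ x

⟦⟧-es : ∀ σ {ρ v} t s → s →S* bang v → ⟦ σ ⟧ (subst (v ∷ₛ ρ) t) →
        ⟦ σ ⟧ (es (subst (exts ρ) t) s)
⟦⟧-es σ {ρ} {v} t s r ⊩t =
  ⟦⟧-backward σ (→S*-esR t' r ◅◅ ↦⇒→S* (ms hole t' v))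
    (transport ⟦ σ ⟧ (sym (msSub-exts ρ v t)) ⊩t)
  where t' = subst (exts ρ) t

⊨-abs : ∀ {Γ t σ} → Γ ⊨ t ∶ σ → tail Γ ⊨ lam t ∶ arr (Γ zero) σ
⊨-abs {t = t} {σ} ⊨t ρ ⊩ρ s (v , r , ⊩v) =
  ⟦⟧-backward σ (↦⇒→S* (dB hole (subst (exts ρ) t) s))
    (transport (⟦ σ ⟧ ∘ es (subst (exts ρ) t)) (sym (rename-id (λ _ → refl) s))
      (⟦⟧-es σ t s r (⊨t (v ∷ₛ ρ) (⊩-∷ₛ ⊩v ⊩ρ))))

≡ᵇ-refl : ∀ x → (x ≡ᵇ x) ≡ true
≡ᵇ-refl zero    = refl
≡ᵇ-refl (suc x) = ≡ᵇ-refl x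

single-self : ∀ x σ → single x σ x ≡ [ σ ]
single-self x σ rewrite ≡ᵇ-refl x = refl

mutual
  adequacy : ∀ {Γ t σ} → Γ ⊢ t ∶ σ → Γ ⊨ t ∶ σ
  adequacy (var x σ) ρ ⊩ρ = proj₁ (transport (λ M → ⟦ M ⟧* (ρ x)) (single-self x σ) (⊩ρ x))
  adequacy (abs {t = t} D) = ⊨-abs {t = t} (adequacy D)
  adequacy (app {u = u} D E) ρ ⊩ρ =
    let (⊩Γ , ⊩Δ) = ⊩-+ₑ ⊩ρ in adequacy D ρ ⊩Γ (subst ρ u) (adequacy E ρ ⊩Δ)
  adequacy (es {Γ} {Δ} {t} {u} {σ} D E) ρ ⊩ρ =
    let (⊩Γ , ⊩Δ) = ⊩-+ₑ {tail Γ} {Δ} ⊩ρ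
        (v , r , ⊩v) = adequacy E ρ ⊩Δ
    in ⟦⟧-es σ t (subst ρ u) r (adequacy D (v ∷ₛ ρ) (⊩-∷ₛ ⊩v ⊩Γ))
  adequacy (bg {t = t} B) ρ ⊩ρ = subst ρ t , ε , adequacy-bg B ρ ⊩ρ
  adequacy (dr {σ = σ} D) ρ ⊩ρ =
    let (v , r , ⊩v , _) = adequacy D ρ ⊩ρ
    in ⟦⟧-backward σ (→S*-der r ◅◅ ↦⇒→S* (dr hole v)) ⊩v

  adequacy-bg : ∀ {Γ t M} → BgPrem Γ t M → ∀ ρ → ρ ⊩ Γ → ⟦ M ⟧* (subst ρ t)
  adequacy-bg []      ρ ⊩ρ = tt
  adequacy-bg (D ∷ B) ρ ⊩ρ =
    let (⊩Γ , ⊩Δ) = ⊩-+ₑ ⊩ρ in adequacy D ρ ⊩Γ , adequacy-bg B ρ ⊩Δ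

fvBound : Term → ℕ
fvBound (var n)   = suc n
fvBound (app t u) = fvBound t ⊔ fvBound u
fvBound (lam t)   = pred (fvBound t)
fvBound (bang t)  = fvBound t
fvBound (der t)   = fvBound t
fvBound (es t u)  = pred (fvBound t) ⊔ fvBound u

<⇒≡ᵇ-false : ∀ {x y} → x < y → (y ≡ᵇ x) ≡ false
<⇒≡ᵇ-false {zero}  {suc y} _       = refl
<⇒≡ᵇ-false {suc x} {suc y} (s≤s p) = <⇒≡ᵇ-false p

pred≤⇒≤suc : ∀ {n y} → pred n ≤ y → n ≤ suc y
pred≤⇒≤suc {zero}  _ = z≤n
pred≤⇒≤suc {suc n} p = s≤s p

++-[] : ∀ {M N : MType} → M ≡ [] → N ≡ [] → M ++ N ≡ []
++-[] refl refl = refl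

mutual
  ⊢-env-beyond-fvBound : ∀ {Γ t σ} → Γ ⊢ t ∶ σ → ∀ y → fvBound t ≤ y → Γ y ≡ []
  ⊢-env-beyond-fvBound (var x σ) y p rewrite <⇒≡ᵇ-false p = refl
  ⊢-env-beyond-fvBound (abs D) y p = ⊢-env-beyond-fvBound D (suc y) (pred≤⇒≤suc p)
  ⊢-env-beyond-fvBound (app {t = t} {u} D E) y p =
    ++-[] (⊢-env-beyond-fvBound D y (m⊔n≤o⇒m≤o (fvBound t) (fvBound u) p))
          (⊢-env-beyond-fvBound E y (m⊔n≤o⇒n≤o (fvBound t) (fvBound u) p))
  ⊢-env-beyond-fvBound (es {t = t} {u} D E) y p =
    ++-[] (⊢-env-beyond-fvBound D (suc y) (pred≤⇒≤suc (m⊔n≤o⇒m≤o (pred (fvBound t)) (fvBound u) p)))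
          (⊢-env-beyond-fvBound E y (m⊔n≤o⇒n≤o (pred (fvBound t)) (fvBound u) p))
  ⊢-env-beyond-fvBound (bg B) y p = bgPrem-env-beyond-fvBound B y p
  ⊢-env-beyond-fvBound (dr D) y p = ⊢-env-beyond-fvBound D y p

  bgPrem-env-beyond-fvBound : ∀ {Γ t M} → BgPrem Γ t M → ∀ y → fvBound t ≤ y → Γ y ≡ []
  bgPrem-env-beyond-fvBound []      y p = refl
  bgPrem-env-beyond-fvBound (D ∷ B) y p =
    ++-[] (⊢-env-beyond-fvBound D y p) (bgPrem-env-beyond-fvBound B y p)

UniformRealiser : Ty → Term → Set
UniformRealiser σ w = ∀ ρ → ⟦ σ ⟧ (subst ρ w)

inhabited⇒uniformRealiser : ∀ {σ} → Inhabited σ → Σ Term (UniformRealiser σ)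
inhabited⇒uniformRealiser (u , Γ , σ' , Γ≈∅ , σ'≈σ , D) =
  u , λ ρ → to (⟦⟧-≈ σ'≈σ (subst ρ u)) (adequacy D ρ λ x → from (⟦⟧*-≈ₘ (Γ≈∅ x) (ρ x)) tt)

-- The empty multitype needs no inhabitant: every !-term realises it.
uniformRealiser-mt : ∀ M → (¬ M ≡ [] → Inhabited (mt M)) → Σ Term (UniformRealiser (mt M))
uniformRealiser-mt []      _   = bang (var 0) , λ ρ → ρ 0 , ε , tt
uniformRealiser-mt (σ ∷ M) inh = inhabited⇒uniformRealiser (inh λ ())

-- (λx₍ₖ₋₁₎. … (λx₀. ⟨⟩) w₀ …) wₖ₋₁ : the j-th innermost binder is fed wⱼ
closingT : ℕ → (ℕ → Term) → TCtx
closingT zero    ws = hole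
closingT (suc k) ws = lamApp (closingT k ws) (ws k)

⊨-closingT : ∀ {Γ t σ} ws → (∀ j → UniformRealiser (mt (Γ j)) (ws j)) → Γ ⊨ t ∶ σ →
             ∀ k → (Γ ∘ (k +_)) ⊨ plugT (closingT k ws) t ∶ σ
⊨-closingT ws ⊩ws ⊨t zero = ⊨t
⊨-closingT {Γ} {t} ws ⊩ws ⊨t (suc k) ρ ⊩ρ =
  ⊨-abs {t = plugT (closingT k ws) t} (⊨-closingT ws ⊩ws ⊨t k) ρ
    (λ x → transport (λ M → ⟦ M ⟧* (ρ x)) (cong Γ (sym (+-suc k x))) (⊩ρ x))
    (subst ρ (ws k))
    (transport (λ M → ⟦ M ⟧ₘ (subst ρ (ws k))) (cong Γ (sym (+-identityʳ k))) (⊩ws k ρ))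

⟦⟧⇒meaningful : ∀ {t} σ T → ⟦ σ ⟧ (plugT T t) → All (Inhabited ∘ mt) (args σ) → Meaningful t
⟦⟧⇒meaningful (atom _)  T ()
⟦⟧⇒meaningful (mt M)    T (v , r , _) _ = T , v , r
⟦⟧⇒meaningful (arr M σ) T ⊩t (inh ∷ inhs) =
  let (w , ⊩w) = inhabited⇒uniformRealiser inh
  in ⟦⟧⇒meaningful σ (appT T (subst var w)) (⊩t (subst var w) (⊩w var)) inhs

testable⇒meaningful : ∀ {Γ t σ} → Γ ⊢ t ∶ σ → Testable Γ σ → Meaningful t
testable⇒meaningful {Γ} {t} {σ} D (inhΓ , inhArgs) =
  ⟦⟧⇒meaningful σ T (transport ⟦ σ ⟧ (subst-id (λ _ → refl) (plugT T t)) ⊩Tt) inhArgs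
  where
  n : ℕ
  n = fvBound t
  ws : ℕ → Term
  ws j = proj₁ (uniformRealiser-mt (Γ j) (inhΓ j))
  T : TCtx
  T = closingT n ws
  ⊩Tt : ⟦ σ ⟧ (subst var (plugT T t))
  ⊩Tt = ⊨-closingT ws (λ j → proj₂ (uniformRealiser-mt (Γ j) (inhΓ j))) (adequacy D) n var
          λ x → transport (λ M → ⟦ M ⟧* (var x))
                  (sym (⊢-env-beyond-fvBound D (n + x) (m≤m+n n x))) tt

mutual
  replace-meaningless : ∀ {t} → Meaningless t → ∀ F {Γ σ} (D : Γ ⊢ plugF F t ∶ σ) →
                        AllJ Testable D → ∀ u → Σ (Γ ⊢ plugF F u ∶ σ) (AllJ Testable)
  replace-meaningless ml hole D (testable , _) u = ⊥-elim (ml (testable⇒meaningful D testable))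
  replace-meaningless ml (appL F s) (app D E) (p , tD , tE) u =
    let (D' , tD') = replace-meaningless ml F D tD u in app D' E , p , tD' , tE
  replace-meaningless ml (appR s F) (app E D) (p , tE , tD) u =
    let (D' , tD') = replace-meaningless ml F D tD u in app E D' , p , tE , tD'
  replace-meaningless ml (lamF F) (abs D) (p , tD) u =
    let (D' , tD') = replace-meaningless ml F D tD u in abs D' , p , tD'
  replace-meaningless ml (derF F) (dr D) (p , tD) u =
    let (D' , tD') = replace-meaningless ml F D tD u in dr D' , p , tD'
  replace-meaningless ml (esL F s) (es D E) (p , tD , tE) u =
    let (D' , tD') = replace-meaningless ml F D tD u in es D' E , p , tD' , tE
  replace-meaningless ml (esR s F) (es E D) (p , tE , tD) u =
    let (D' , tD') = replace-meaningless ml F D tD u in es E D' , p , tE , tD'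
  replace-meaningless ml (bangF F) (bg B) (p , tB) u =
    let (B' , tB') = replace-meaningless-bg ml F B tB u in bg B' , p , tB'

  replace-meaningless-bg : ∀ {t} → Meaningless t → ∀ F {Γ M} (B : BgPrem Γ (plugF F t) M) →
                           AllBg Testable B → ∀ u → Σ (BgPrem Γ (plugF F u) M) (AllBg Testable)
  replace-meaningless-bg ml F []      _          u = [] , tt
  replace-meaningless-bg ml F (D ∷ B) (tD , tB) u =
    let (D' , tD') = replace-meaningless ml F D tD u
        (B' , tB') = replace-meaningless-bg ml F B tB u
    in D' ∷ B' , tD' , tB'

mutual
  ≈-refl : ∀ σ → σ ≈ σ
  ≈-refl (atom n)  = atom n
  ≈-refl (mt M)    = mt (≈ₘ-refl M)
  ≈-refl (arr M σ) = arr (≈ₘ-refl M) (≈-refl σ)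

  ≈ₘ-refl : ∀ M → M ≈ₘ M
  ≈ₘ-refl []      = []
  ≈ₘ-refl (σ ∷ M) = ≈-refl σ ∷ ≈ₘ-refl M

theorem4p2 : (t : Term) → Meaningless t → (F : FCtx) (Γ : Env) (σ : Ty) →
    (D : Γ ⊢ plugF F t ∶ σ) → AllJ Testable D →
    (u : Term) → Σ Env λ Γ' → Σ Ty λ σ' → Γ' ≈ₑ Γ × σ' ≈ σ ×
      Σ (Γ' ⊢ plugF F u ∶ σ') (AllJ Testable)
theorem4p2 t ml F Γ σ D testable u =
  Γ , σ , ≈ₘ-refl ∘ Γ , ≈-refl σ , replace-meaningless ml F D testable u
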